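{- Let $\mathcal{V}\subseteq\mathcal{RL}$ be a variety and $t(x)$ a unary term that is a nucleus on $\mathcal{V}$. (i) If $\mathcal{V}\models t(\bot)\approx\top$, then $\mathcal{V}\models t(x)\approx\top$. (ii) If $\mathcal{V}\models t(\bot)\approx\bot$, then $\mathcal{V}\models (x\to t(x))\wedge(t(x)\to\neg\neg x)\approx\top$.
   Context: A residuated lattice is an algebra $\mathbf{A}=\langle A,\wedge,\vee,\cdot,\to,\bot,\top\rangle$ such that $\langle A,\wedge,\vee,\bot,\top\rangle$ is a bounded lattice, $\langle A,\cdot,\top\rangle$ is a commutative monoid, and $a\cdot b\le c$ iff $a\le b\to c$; $\mathcal{RL}$ is the variety of all residuated lattices. $\neg x:=x\to\bot$. A nucleus on $\mathbf{A}$ is a map $\gamma:A\to A$ with $a\le\gamma(a)$, $a\le b\Rightarrow\gamma(a)\le\gamma(b)$, $\gamma(\gamma(a))=\gamma(a)$ and $\gamma(a)\cdot\gamma(b)\le\gamma(a\cdot b)$. A term $t(x)$ is a nucleus on $\mathcal{V}$ if $t^{\mathbf{A}}$ is a nucleus on $\mathbf{A}$ for every $\mathbf{A}\in\mathcal{V}$. -}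

module Defs where

open import Data.Nat using (ℕ)
open import Data.Unit using (⊤; tt)
open import Data.Product using (_×_; _,_; proj₁; proj₂)
open import Relation.Binary.PropositionalEquality using (_≡_)

record ResiduatedLattice : Set₁ where
  infixr 6 _∨_
  infixr 7 _∧_
  infixr 8 _·_
  infixr 5 _⇒_
  field
    Carrier : Set
    _∧_ _∨_ _·_ _⇒_ : Carrier → Carrier → Carrier
    bot top : Carrier
    ∧-assoc : ∀ a b c → (a ∧ b) ∧ c ≡ a ∧ (b ∧ c)
    ∨-assoc : ∀ a b c → (a ∨ b) ∨ c ≡ a ∨ (b ∨ c)
    ∧-comm : ∀ a b → a ∧ b ≡ b ∧ a
    ∨-comm : ∀ a b → a ∨ b ≡ b ∨ a
    ∧-absorb-∨ : ∀ a b → a ∧ (a ∨ b) ≡ a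
    ∨-absorb-∧ : ∀ a b → a ∨ (a ∧ b) ≡ a
    bot-least : ∀ a → bot ∧ a ≡ bot
    top-greatest : ∀ a → a ∧ top ≡ a
    ·-assoc : ∀ a b c → (a · b) · c ≡ a · (b · c)
    ·-comm : ∀ a b → a · b ≡ b · a
    ·-identity : ∀ a → a · top ≡ a
    -- residuation: a · b ≤ c iff a ≤ b ⇒ c
    residuate : ∀ a b c → (a · b) ∧ c ≡ a · b → a ∧ (b ⇒ c) ≡ a
    unresiduate : ∀ a b c → a ∧ (b ⇒ c) ≡ a → (a · b) ∧ c ≡ a · b

  _≤_ : Carrier → Carrier → Set
  a ≤ b = a ∧ b ≡ a

  ¬_ : Carrier → Carrier
  ¬ a = a ⇒ bot

data Term (X : Set) : Set where
  var : X → Term X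
  _∧'_ _∨'_ _·'_ _⇒'_ : Term X → Term X → Term X
  bot' top' : Term X

eval : {X : Set} (A : ResiduatedLattice) → (X → ResiduatedLattice.Carrier A) →
       Term X → ResiduatedLattice.Carrier A
eval A v (var x) = v x
eval A v (s ∧' t) = ResiduatedLattice._∧_ A (eval A v s) (eval A v t)
eval A v (s ∨' t) = ResiduatedLattice._∨_ A (eval A v s) (eval A v t)
eval A v (s ·' t) = ResiduatedLattice._·_ A (eval A v s) (eval A v t)
eval A v (s ⇒' t) = ResiduatedLattice._⇒_ A (eval A v s) (eval A v t)
eval A v bot' = ResiduatedLattice.bot A
eval A v top' = ResiduatedLattice.top A

Equation : Set
Equation = Term ℕ × Term ℕ

Satisfies : ResiduatedLattice → Equation → Set
Satisfies A e = ∀ (v : ℕ → ResiduatedLattice.Carrier A) →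
  eval A v (proj₁ e) ≡ eval A v (proj₂ e)

-- A variety of residuated lattices, presented (Birkhoff) by a set of
-- equations E : the class of residuated lattices satisfying every equation of E.
Variety : Set₁
Variety = Equation → Set

_∈V_ : ResiduatedLattice → Variety → Set
A ∈V E = ∀ e → E e → Satisfies A e

UnaryTerm : Set
UnaryTerm = Term ⊤

apply : (A : ResiduatedLattice) → UnaryTerm →
        ResiduatedLattice.Carrier A → ResiduatedLattice.Carrier A
apply A t a = eval A (λ _ → a) t

record IsNucleus (A : ResiduatedLattice) (γ : ResiduatedLattice.Carrier A → ResiduatedLattice.Carrier A) : Set where
  open ResiduatedLattice A
  field
    extensive : ∀ a → a ≤ γ a
    monotone : ∀ a b → a ≤ b → γ a ≤ γ b
    idempotent : ∀ a → γ (γ a) ≡ γ a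
    submult : ∀ a b → (γ a · γ b) ≤ γ (a · b)

NucleusOn : Variety → UnaryTerm → Set₁
NucleusOn V t = ∀ (A : ResiduatedLattice) → A ∈V V → IsNucleus A (apply A t)

-- (i) A nucleus is monotone and ⊥ is least, so ⊤ = γ ⊥ ≤ γ a.
-- (ii) Both implications are ⊤ as soon as a ≤ γ a ≤ ¬ ¬ a. The first is
-- extensivity; for the second, γ a · ¬ a ≤ γ a · γ (¬ a) ≤ γ (a · ¬ a) ≤ γ ⊥ = ⊥,
-- and residuation turns this into γ a ≤ ¬ a ⇒ ⊥. Both arguments take place
-- in a single algebra, so the variety only serves to make t a nucleus there.
module Submission where

open import Defs
open import Data.Product using (_×_; _,_)
open import Level using (0ℓ)
open import Relation.Binary.Bundles using (Poset)
open import Relation.Binary.PropositionalEquality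
  using (_≡_; refl; sym; trans; cong; cong₂; subst; subst₂; isEquivalence; module ≡-Reasoning)

module ResiduatedLatticeProperties (A : ResiduatedLattice) where
  open ResiduatedLattice A

  ∧-idem : ∀ a → a ∧ a ≡ a
  ∧-idem a = begin
    a ∧ a             ≡⟨ cong (a ∧_) (sym (∨-absorb-∧ a a)) ⟩
    a ∧ (a ∨ a ∧ a)   ≡⟨ ∧-absorb-∨ a (a ∧ a) ⟩
    a                 ∎
    where open ≡-Reasoning

  ≤-reflexive : ∀ {a b} → a ≡ b → a ≤ b
  ≤-reflexive {a} refl = ∧-idem a

  ≤-trans : ∀ {a b c} → a ≤ b → b ≤ c → a ≤ c
  ≤-trans {a} {b} {c} a≤b b≤c = begin
    a ∧ c         ≡⟨ cong (_∧ c) (sym a≤b) ⟩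
    (a ∧ b) ∧ c   ≡⟨ ∧-assoc a b c ⟩
    a ∧ (b ∧ c)   ≡⟨ cong (a ∧_) b≤c ⟩
    a ∧ b         ≡⟨ a≤b ⟩
    a             ∎
    where open ≡-Reasoning

  ≤-antisym : ∀ {a b} → a ≤ b → b ≤ a → a ≡ b
  ≤-antisym {a} {b} a≤b b≤a = trans (sym a≤b) (trans (∧-comm a b) b≤a)

  ≤-poset : Poset 0ℓ 0ℓ 0ℓ
  ≤-poset = record
    { Carrier = Carrier
    ; _≈_ = _≡_
    ; _≤_ = _≤_
    ; isPartialOrder = record
      { isPreorder = record
        { isEquivalence = isEquivalence
        ; reflexive = ≤-reflexive
        ; trans = ≤-trans
        }
      ; antisym = ≤-antisym
      }
    }

  top≤⇒≡top : ∀ {a} → top ≤ a → a ≡ top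
  top≤⇒≡top {a} top≤a = ≤-antisym (top-greatest a) top≤a

  ·-identityˡ : ∀ a → top · a ≡ a
  ·-identityˡ a = trans (·-comm top a) (·-identity a)

  ≤⇒⇒≡top : ∀ {a b} → a ≤ b → (a ⇒ b) ≡ top
  ≤⇒⇒≡top {a} {b} a≤b =
    top≤⇒≡top (residuate top a b (subst (_≤ b) (sym (·-identityˡ a)) a≤b))

  ·-monoˡ-≤ : ∀ {a b} c → a ≤ b → (a · c) ≤ (b · c)
  ·-monoˡ-≤ {a} {b} c a≤b =
    unresiduate a c (b · c) (≤-trans a≤b (residuate b c (b · c) (∧-idem (b · c))))

  ·-monoʳ-≤ : ∀ {b c} a → b ≤ c → (a · b) ≤ (a · c)
  ·-monoʳ-≤ {b} {c} a b≤c =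
    subst₂ _≤_ (·-comm b a) (·-comm c a) (·-monoˡ-≤ a b≤c)

  ·-¬-≤-bot : ∀ a → (a · ¬ a) ≤ bot
  ·-¬-≤-bot a = subst (_≤ bot) (·-comm (¬ a) a) (unresiduate (¬ a) a bot (∧-idem (¬ a)))

module NucleusProperties
  (A : ResiduatedLattice)
  {γ : ResiduatedLattice.Carrier A → ResiduatedLattice.Carrier A}
  (isNucleus : IsNucleus A γ)
  where
  open ResiduatedLattice A
  open ResiduatedLatticeProperties A
  open IsNucleus isNucleus

  γ-bot≡top⇒γ≡top : γ bot ≡ top → ∀ a → γ a ≡ top
  γ-bot≡top⇒γ≡top γbot≡top a =
    top≤⇒≡top (subst (_≤ γ a) γbot≡top (monotone bot a (bot-least a)))

  γ-bot≡bot⇒γ≤¬¬ : γ bot ≡ bot → ∀ a → γ a ≤ (¬ ¬ a)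
  γ-bot≡bot⇒γ≤¬¬ γbot≡bot a = residuate (γ a) (¬ a) bot γa·¬a≤bot
    where
    open import Relation.Binary.Reasoning.PartialOrder ≤-poset
    γa·¬a≤bot : (γ a · ¬ a) ≤ bot
    γa·¬a≤bot = begin
      γ a · ¬ a       ≤⟨ ·-monoʳ-≤ (γ a) (extensive (¬ a)) ⟩
      γ a · γ (¬ a)   ≤⟨ submult a (¬ a) ⟩
      γ (a · ¬ a)     ≤⟨ monotone (a · ¬ a) bot (·-¬-≤-bot a) ⟩
      γ bot           ≡⟨ γbot≡bot ⟩
      bot             ∎

  γ-bot≡bot⇒⇒γ∧γ⇒¬¬≡top : γ bot ≡ bot → ∀ a → (a ⇒ γ a) ∧ (γ a ⇒ ¬ ¬ a) ≡ top
  γ-bot≡bot⇒⇒γ∧γ⇒¬¬≡top γbot≡bot a = begin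
    (a ⇒ γ a) ∧ (γ a ⇒ ¬ ¬ a)   ≡⟨ cong₂ _∧_ (≤⇒⇒≡top (extensive a))
                                             (≤⇒⇒≡top (γ-bot≡bot⇒γ≤¬¬ γbot≡bot a)) ⟩
    top ∧ top                   ≡⟨ ∧-idem top ⟩
    top                         ∎
    where open ≡-Reasoning

mainTheorem8 : (V : Variety) (t : UnaryTerm) → NucleusOn V t →
    ((∀ (A : ResiduatedLattice) → A ∈V V →
        apply A t (ResiduatedLattice.bot A) ≡ ResiduatedLattice.top A) →
      ∀ (A : ResiduatedLattice) → A ∈V V → ∀ a →
        apply A t a ≡ ResiduatedLattice.top A)
    ×
    ((∀ (A : ResiduatedLattice) → A ∈V V →
        apply A t (ResiduatedLattice.bot A) ≡ ResiduatedLattice.bot A) →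
      ∀ (A : ResiduatedLattice) → A ∈V V → ∀ a →
        ResiduatedLattice._∧_ A
          (ResiduatedLattice._⇒_ A a (apply A t a))
          (ResiduatedLattice._⇒_ A (apply A t a)
            (ResiduatedLattice.¬_ A (ResiduatedLattice.¬_ A a)))
        ≡ ResiduatedLattice.top A)
mainTheorem8 V t t-nucleus =
    (λ tbot≡top A A∈V → NucleusProperties.γ-bot≡top⇒γ≡top A (t-nucleus A A∈V) (tbot≡top A A∈V))
  , (λ tbot≡bot A A∈V → NucleusProperties.γ-bot≡bot⇒⇒γ∧γ⇒¬¬≡top A (t-nucleus A A∈V) (tbot≡bot A A∈V))
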